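{- Let $D=(d_1,\ldots,d_n)$ be a forcibly bicyclic graphic sequence. If $D$ has a realization $G$ containing a theta graph $\Theta(1,2,t)$ as a subgraph, then $2\le t\le 4$.
   Context: All graphs are simple. A realization of a sequence $D=(d_1,\ldots,d_n)$ is a simple graph with vertices $v_1,\ldots,v_n$ with $\deg(v_i)=d_i$; $D$ is graphic if it has a realization. A graphic sequence is forcibly bicyclic if every realization of it is connected and has exactly $n+1$ edges. $P_k$ denotes the path with $k+1$ vertices (length $k$). The theta graph $\Theta(r,s,t)$ is obtained from paths $P_r,P_s,P_t$ (of lengths $r,s,t$) by identifying one end vertex of each into a single vertex and identifying the other end vertices of each into another single vertex. -}

module Defs where

open import Data.Nat using (ℕ; zero; suc; _+_; _<ᵇ_)
open import Data.Fin using (Fin; toℕ; fromℕ; inject₁) renaming (zero to fzero; suc to fsuc)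
open import Data.Bool using (Bool; true; false; if_then_else_; _∧_)
open import Data.List using (List; allFin; map)
open import Data.Nat.ListAction using (sum)
open import Data.Product using (Σ; _×_; _,_; ∃-syntax)
open import Data.Sum using (_⊎_)
open import Relation.Binary.PropositionalEquality using (_≡_)
open import Relation.Nullary using (¬_)

-- A simple graph on vertex set Fin n (vertex i stands for v_{i+1}):
-- a symmetric, irreflexive Boolean adjacency relation.
record Graph (n : ℕ) : Set where
  field
    adj    : Fin n → Fin n → Bool
    sym    : ∀ i j → adj i j ≡ adj j i
    irrefl : ∀ i → adj i i ≡ false
open Graph public

deg : ∀ {n} → Graph n → Fin n → ℕ
deg {n} G i = sum (map (λ j → if adj G i j then 1 else 0) (allFin n))

edgeCount : ∀ {n} → Graph n → ℕ
edgeCount {n} G =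
  sum (map (λ i → sum (map (λ j → if adj G i j ∧ (toℕ i <ᵇ toℕ j) then 1 else 0)
                            (allFin n)))
           (allFin n))

data Walk {n : ℕ} (G : Graph n) : Fin n → Fin n → Set where
  here : ∀ {i} → Walk G i i
  step : ∀ {i j k} → adj G i j ≡ true → Walk G j k → Walk G i k

Connected : ∀ {n} → Graph n → Set
Connected {n} G = (i j : Fin n) → Walk G i j

Realization : ∀ {n} → Graph n → (Fin n → ℕ) → Set
Realization {n} G D = (i : Fin n) → deg G i ≡ D i

Graphic : ∀ {n} → (Fin n → ℕ) → Set
Graphic {n} D = Σ (Graph n) λ G → Realization G D

ForciblyBicyclic : ∀ {n} → (Fin n → ℕ) → Set
ForciblyBicyclic {n} D =
  Graphic D × ((G : Graph n) → Realization G D → Connected G × edgeCount G ≡ n + 1)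

record Path {n : ℕ} (G : Graph n) (k : ℕ) (u v : Fin n) : Set where
  field
    vert   : Fin (suc k) → Fin n
    inj    : ∀ a b → vert a ≡ vert b → a ≡ b
    start  : vert fzero ≡ u
    end    : vert (fromℕ k) ≡ v
    edges  : (a : Fin k) → adj G (vert (inject₁ a)) (vert (fsuc a)) ≡ true
open Path public

SameEdge : ∀ {n} → Fin n → Fin n → Fin n → Fin n → Set
SameEdge a b c d = (a ≡ c × b ≡ d) ⊎ (a ≡ d × b ≡ c)

Independent : ∀ {n} {G : Graph n} {k l : ℕ} {u v : Fin n} →
              Path G k u v → Path G l u v → Set
Independent {k = k} {l} {u} {v} P Q =
  ((a : Fin (suc k)) (b : Fin (suc l)) → vert P a ≡ vert Q b → (vert P a ≡ u) ⊎ (vert P a ≡ v))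
  × ((a : Fin k) (b : Fin l) →
       ¬ SameEdge (vert P (inject₁ a)) (vert P (fsuc a)) (vert Q (inject₁ b)) (vert Q (fsuc b)))

ContainsTheta : ∀ {n} → Graph n → ℕ → ℕ → ℕ → Set
ContainsTheta {n} G r s t =
  ∃[ u ] ∃[ v ] (¬ u ≡ v) ×
    (Σ (Path G r u v) λ P → Σ (Path G s u v) λ Q → Σ (Path G t u v) λ R →
       Independent P Q × Independent P R × Independent Q R)

-- A forcibly bicyclic sequence has only connected realizations with n + 1 edges, and a connected
-- graph on n vertices keeps at least n − 1 edges, so no realization has three edges whose deletion
-- leaves it connected.  Read Θ(1,2,t) as a triangle u w v plus a path u = y₀, y₁, …, y_t = v, and
-- suppose t ≥ 5.  Deleting u w, y₂ y₃ and u y₁ keeps the graph connected as soon as y₂ y₄ or y₁ y₅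
-- is an edge: u w is bypassed through v, and the other two through the chord and the rest of the
-- path.  If neither chord is present, the 2-switch trading y₁ y₂, y₄ y₅ for y₁ y₅, y₂ y₄ yields a
-- realization of the same sequence in which the same three deletions again keep it connected.
-- Finally t ≥ 2, since t = 0 would identify u with v and t = 1 would repeat the edge u v.

module Submission where

open import Defs hiding (sym)
import Data.Nat as ℕ
open import Data.Nat using (ℕ; zero; suc; _+_; _≤_; _<_; _≤′_; ≤′-refl; ≤′-step; _<ᵇ_; _≤ᵇ_; z≤n; s≤s; z<s)
open import Data.Nat.Properties
  using (≤-refl; ≤-trans; <-≤-trans; <⇒≤; <⇒≢; <-cmp; n≮n; n≤1+n; m≤m+n; m<n⇒m<1+n; ≰⇒>;
         m≤n⇒∃[o]m+o≡n; ≤′⇒≤; ≤⇒≤′; ≤ᵇ⇒≤; <ᵇ⇒<; <⇒<ᵇ; suc-injective; 0≢1+n;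
         +-assoc; +-comm; +-mono-≤; +-mono-<-≤; module ≤-Reasoning)
open import Data.Nat.ListAction as List using ()
open import Algebra.Properties.CommutativeMonoid.Sum Data.Nat.Properties.+-0-commutativeMonoid
  using (sum; sum-syntax; sum-remove; sum-cong-≗; sum-replicate-zero)
open import Data.Fin using (Fin; toℕ; fromℕ; fromℕ<; inject₁; punchIn; punchOut; _≟_)
  renaming (zero to fzero; suc to fsuc)
open import Data.Fin.Properties
  using (toℕ-injective; punchIn-injective; punchInᵢ≢i; punchIn-punchOut; ¬∀⟶∃¬; toℕ-inject₁;
         toℕ-fromℕ; toℕ-fromℕ<)
open import Data.Vec.Functional using (removeAt)
open import Algebra.Properties.CommutativeSemigroup Data.Nat.Properties.+-commutativeSemigroup
  using (x∙yz≈y∙xz)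
open import Data.Bool using (Bool; true; false; if_then_else_; _∧_; _∨_; not; _xor_; T)
open import Data.Bool.Properties using (xor-identityʳ; T-≡; ∧-zeroʳ; ∨-zeroʳ; ∨-identityʳ; ¬-not)
open import Data.List using (allFin; map; tabulate)
open import Data.List.Properties using (map-tabulate)
open import Data.Product using (_×_; _,_; ∃-syntax)
open import Data.Sum as Sum using (_⊎_; inj₁; inj₂; [_,_])
open import Data.Empty using (⊥)
open import Function using (_∘_; id; Equivalence; mk⇔)
open import Relation.Binary using (tri<; tri≈; tri>)
open import Relation.Binary.PropositionalEquality
  using (_≡_; _≢_; refl; sym; trans; cong; cong₂; subst; subst₂; ≢-sym; module ≡-Reasoning)
open import Relation.Nullary using (¬_; Dec; yes; no; does; contradiction)
open import Relation.Nullary.Decidable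
  using (False; toWitnessFalse; _×-dec_; _⊎-dec_; dec-true; dec-false; does-⇔)

bit : Bool → ℕ
bit b = if b then 1 else 0

bit-mono : ∀ {a b} → (a ≡ true → b ≡ true) → bit a ≤ bit b
bit-mono {false} _ = z≤n
bit-mono {true} a⇒b rewrite a⇒b refl = ≤-refl

sum-tabulate : ∀ {n} (f : Fin n → ℕ) → List.sum (tabulate f) ≡ sum f
sum-tabulate {zero} f = refl
sum-tabulate {suc n} f = cong (f fzero +_) (sum-tabulate (f ∘ fsuc))

sum-allFin : ∀ {n} (f : Fin n → ℕ) → List.sum (map f (allFin n)) ≡ sum f
sum-allFin f = trans (cong List.sum (map-tabulate id f)) (sum-tabulate f)

sum-ones : ∀ n → ∑[ i < n ] 1 ≡ n
sum-ones zero = refl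
sum-ones (suc n) = cong suc (sum-ones n)

sum-mono : ∀ {n} {f g : Fin n → ℕ} → (∀ i → f i ≤ g i) → sum f ≤ sum g
sum-mono {zero} _ = z≤n
sum-mono {suc n} f≤g = +-mono-≤ (f≤g fzero) (sum-mono (f≤g ∘ fsuc))

sum-mono-< : ∀ {n} {f g : Fin n → ℕ} (p : Fin n) → (∀ i → f i ≤ g i) → f p < g p → sum f < sum g
sum-mono-< {suc n} {f} {g} p f≤g fp<gp = begin-strict
  sum f                      ≡⟨ sum-remove {i = p} f ⟩
  f p + sum (removeAt f p)   <⟨ +-mono-<-≤ fp<gp (sum-mono (f≤g ∘ punchIn p)) ⟩
  g p + sum (removeAt g p)   ≡⟨ sym (sum-remove {i = p} g) ⟩
  sum g                      ∎
  where open ≤-Reasoning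

sum-removeAt-cong : ∀ {n} {f g : Fin (suc n) → ℕ} (p : Fin (suc n)) →
                    (∀ j → j ≢ p → f j ≡ g j) → sum (removeAt f p) ≡ sum (removeAt g p)
sum-removeAt-cong p f≡g = sum-cong-≗ (λ j → f≡g (punchIn p j) (punchInᵢ≢i p j))

sum-differ-at : ∀ {n} {f g : Fin n → ℕ} (p : Fin n) → (∀ j → j ≢ p → f j ≡ g j) → f p + sum g ≡ g p + sum f
sum-differ-at {suc n} {f} {g} p f≡g = begin
  f p + sum g                          ≡⟨ cong (f p +_) (sum-remove {i = p} g) ⟩
  f p + (g p + sum (removeAt g p))     ≡⟨ x∙yz≈y∙xz (f p) (g p) _ ⟩
  g p + (f p + sum (removeAt g p))     ≡⟨ cong (λ s → g p + (f p + s)) (sym (sum-removeAt-cong p f≡g)) ⟩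
  g p + (f p + sum (removeAt f p))     ≡⟨ cong (g p +_) (sym (sum-remove {i = p} f)) ⟩
  g p + sum f                          ∎
  where open ≡-Reasoning

sum-differ-at₂ : ∀ {n} {f g : Fin n → ℕ} {p q : Fin n} → p ≢ q →
           (∀ j → j ≢ p → j ≢ q → f j ≡ g j) → f p + f q ≡ g p + g q → sum f ≡ sum g
sum-differ-at₂ {suc zero} {p = fzero} {fzero} p≢q _ _ = contradiction refl p≢q
sum-differ-at₂ {suc (suc n)} {f} {g} {p} {q} p≢q f≡g fp+fq≡gp+gq = begin
  sum f                        ≡⟨ sum-remove {i = p} f ⟩
  f p + sum f′                 ≡⟨ cong (f p +_) (sum-remove {i = q′} f′) ⟩
  f p + (f′ q′ + sum f″)       ≡⟨ cong (λ x → f p + (x + sum f″)) f′q′≡fq ⟩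
  f p + (f q + sum f″)         ≡⟨ sym (+-assoc (f p) (f q) _) ⟩
  f p + f q + sum f″           ≡⟨ cong₂ _+_ fp+fq≡gp+gq (sum-removeAt-cong q′ f′≡g′) ⟩
  g p + g q + sum g″           ≡⟨ +-assoc (g p) (g q) _ ⟩
  g p + (g q + sum g″)         ≡⟨ cong (λ x → g p + (x + sum g″)) (sym g′q′≡gq) ⟩
  g p + (g′ q′ + sum g″)       ≡⟨ cong (g p +_) (sym (sum-remove {i = q′} g′)) ⟩
  g p + sum g′                 ≡⟨ sym (sum-remove {i = p} g) ⟩
  sum g                        ∎
  where
  open ≡-Reasoning
  q′ : Fin (suc n)
  q′ = punchOut p≢q
  f′ g′ : Fin (suc n) → ℕ
  f′ = removeAt f p
  g′ = removeAt g p
  f″ g″ : Fin n → ℕ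
  f″ = removeAt f′ q′
  g″ = removeAt g′ q′
  f′q′≡fq : f′ q′ ≡ f q
  f′q′≡fq = cong f (punchIn-punchOut p≢q)
  g′q′≡gq : g′ q′ ≡ g q
  g′q′≡gq = cong g (punchIn-punchOut p≢q)
  f′≡g′ : ∀ j → j ≢ q′ → f′ j ≡ g′ j
  f′≡g′ j j≢q′ = f≡g (punchIn p j) (punchInᵢ≢i p j)
    (λ e → j≢q′ (punchIn-injective p j q′ (trans e (sym (punchIn-punchOut p≢q)))))

sum-bit-xor : ∀ {n} (x τ : Fin n → Bool) {p q : Fin n} → p ≢ q → τ p ≡ true → τ q ≡ true →
              (∀ j → j ≢ p → j ≢ q → τ j ≡ false) → x p ≡ not (x q) →
              sum (λ j → bit (x j xor τ j)) ≡ sum (λ j → bit (x j))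
sum-bit-xor x τ {p} {q} p≢q τp τq τ-off xp≡¬xq = sum-differ-at₂ p≢q
  (λ j j≢p j≢q → trans (cong (λ b → bit (x j xor b)) (τ-off j j≢p j≢q)) (cong bit (xor-identityʳ (x j))))
  (swapped (x p) (x q) xp≡¬xq)
  where
  swapped : ∀ a b → a ≡ not b → bit (a xor τ p) + bit (b xor τ q) ≡ bit a + bit b
  swapped _ true refl rewrite τp | τq = refl
  swapped _ false refl rewrite τp | τq = refl

edgeCountOf : ∀ {n} → (Fin n → Fin n → Bool) → ℕ
edgeCountOf {n} A = ∑[ i < n ] ∑[ j < n ] bit (A i j ∧ (toℕ i <ᵇ toℕ j))

edgeCount≡edgeCountOf : ∀ {n} (G : Graph n) → edgeCount G ≡ edgeCountOf (adj G)
edgeCount≡edgeCountOf {n} G =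
  trans (sum-allFin row) (sum-cong-≗ (λ i → sum-allFin (λ j → bit (adj G i j ∧ (toℕ i <ᵇ toℕ j)))))
  where
  row : Fin n → ℕ
  row i = List.sum (map (λ j → bit (adj G i j ∧ (toℕ i <ᵇ toℕ j))) (allFin n))

deg≡sum : ∀ {n} (G : Graph n) i → deg G i ≡ ∑[ j < n ] bit (adj G i j)
deg≡sum G i = sum-allFin (λ j → bit (adj G i j))

_⊆ᵃ_ : ∀ {n} → (Fin n → Fin n → Bool) → (Fin n → Fin n → Bool) → Set
A ⊆ᵃ B = ∀ i j → A i j ≡ true → B i j ≡ true

∧-monoˡ : ∀ {a b} c → (a ≡ true → b ≡ true) → a ∧ c ≡ true → b ∧ c ≡ true
∧-monoˡ {true} c a⇒b ac rewrite a⇒b refl = ac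

entry-mono : ∀ {n} {A B : Fin n → Fin n → Bool} → A ⊆ᵃ B →
             ∀ i j → bit (A i j ∧ (toℕ i <ᵇ toℕ j)) ≤ bit (B i j ∧ (toℕ i <ᵇ toℕ j))
entry-mono A⊆B i j = bit-mono (∧-monoˡ (toℕ i <ᵇ toℕ j) (A⊆B i j))

edgeCountOf-mono : ∀ {n} {A B : Fin n → Fin n → Bool} → A ⊆ᵃ B → edgeCountOf A ≤ edgeCountOf B
edgeCountOf-mono A⊆B = sum-mono (λ i → sum-mono (entry-mono A⊆B i))

edgeCountOf-mono-<-ordered : ∀ {n} {A B : Fin n → Fin n → Bool} {p q : Fin n} → A ⊆ᵃ B →
                             toℕ p < toℕ q → B p q ≡ true → A p q ≡ false →
                             edgeCountOf A < edgeCountOf B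
edgeCountOf-mono-<-ordered {A = A} {B} {p} {q} A⊆B p<q Bpq Apq =
  sum-mono-< p (λ i → sum-mono (entry-mono A⊆B i)) (sum-mono-< q (entry-mono A⊆B p) gained)
  where
  gained : bit (A p q ∧ (toℕ p <ᵇ toℕ q)) < bit (B p q ∧ (toℕ p <ᵇ toℕ q))
  gained rewrite Apq | Bpq | Equivalence.to T-≡ (<⇒<ᵇ p<q) = z<s
  
edgeCountOf-mono-< : ∀ {n} {A B : Fin n → Fin n → Bool} {p q : Fin n} → A ⊆ᵃ B → p ≢ q →
                     B p q ≡ true → B q p ≡ true → A p q ≡ false → A q p ≡ false →
                     edgeCountOf A < edgeCountOf B
edgeCountOf-mono-< {p = p} {q} A⊆B p≢q Bpq Bqp Apq Aqp with <-cmp (toℕ p) (toℕ q)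
... | tri< p<q _ _ = edgeCountOf-mono-<-ordered A⊆B p<q Bpq Apq
... | tri≈ _ p≡q _ = contradiction (toℕ-injective p≡q) p≢q
... | tri> _ _ q<p = edgeCountOf-mono-<-ordered A⊆B q<p Bqp Aqp

adj-flip : ∀ {n} (G : Graph n) {i j} → adj G i j ≡ true → adj G j i ≡ true
adj-flip G {i} {j} e = trans (Graph.sym G j i) e

infixr 5 _++ʷ_
_++ʷ_ : ∀ {n} {G : Graph n} {i j k} → Walk G i j → Walk G j k → Walk G i k
here ++ʷ q = q
step e p ++ʷ q = step e (p ++ʷ q)

edgeʷ : ∀ {n} {G : Graph n} {i j} → adj G i j ≡ true → Walk G i j
edgeʷ e = step e here

reverseʷ : ∀ {n} {G : Graph n} {i j} → Walk G i j → Walk G j i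
reverseʷ here = here
reverseʷ {G = G} (step e p) = reverseʷ p ++ʷ edgeʷ (adj-flip G e)

mapʷ : ∀ {n} {G H : Graph n} → (∀ i j → adj G i j ≡ true → Walk H i j) → ∀ {i j} → Walk G i j → Walk H i j
mapʷ f here = here
mapʷ f (step {i} {j} e p) = f i j e ++ʷ mapʷ f p

weakenʷ : ∀ {n} {G H : Graph n} → adj G ⊆ᵃ adj H → ∀ {i j} → Walk G i j → Walk H i j
weakenʷ G⊆H = mapʷ (λ i j e → edgeʷ (G⊆H i j e))

walk-along : ∀ {n} {G : Graph n} (y : ℕ → Fin n) {lo hi} → lo ≤′ hi →
             (∀ k → lo ≤ k → k < hi → adj G (y k) (y (suc k)) ≡ true) → Walk G (y lo) (y hi)
walk-along y ≤′-refl _ = here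
walk-along y (≤′-step lo≤′h) e =
  walk-along y lo≤′h (λ k lo≤k k<h → e k lo≤k (m<n⇒m<1+n k<h)) ++ʷ edgeʷ (e _ (≤′⇒≤ lo≤′h) ≤-refl)

adj⇒≢ : ∀ {n} (G : Graph n) {a b} → adj G a b ≡ true → a ≢ b
adj⇒≢ G {a} e refl with () ← trans (sym e) (Graph.irrefl G a)

sameEdge? : ∀ {n} (i j a b : Fin n) → Dec (SameEdge i j a b)
sameEdge? i j a b = (i ≟ a ×-dec j ≟ b) ⊎-dec (i ≟ b ×-dec j ≟ a)

SameEdge-flip : ∀ {n} {i j a b : Fin n} → SameEdge i j a b → SameEdge j i a b
SameEdge-flip (inj₁ (i≡a , j≡b)) = inj₂ (j≡b , i≡a)
SameEdge-flip (inj₂ (i≡b , j≡a)) = inj₁ (j≡a , i≡b)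

¬SameEdge : ∀ {n} {i j a b : Fin n} → (i ≢ a ⊎ j ≢ b) → (i ≢ b ⊎ j ≢ a) → ¬ SameEdge i j a b
¬SameEdge (inj₁ i≢a) _ (inj₁ (i≡a , _)) = i≢a i≡a
¬SameEdge (inj₂ j≢b) _ (inj₁ (_ , j≡b)) = j≢b j≡b
¬SameEdge _ (inj₁ i≢b) (inj₂ (i≡b , _)) = i≢b i≡b
¬SameEdge _ (inj₂ j≢a) (inj₂ (_ , j≡a)) = j≢a j≡a

walk-SameEdge : ∀ {n} {G : Graph n} {i j a b} → SameEdge i j a b → Walk G a b → Walk G i j
walk-SameEdge (inj₁ (refl , refl)) w = w
walk-SameEdge (inj₂ (refl , refl)) w = reverseʷ w

deleteEdge : ∀ {n} → Graph n → Fin n → Fin n → Graph n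
deleteEdge G a b = record
  { adj    = λ i j → adj G i j ∧ not (does (sameEdge? i j a b))
  ; sym    = λ i j → cong₂ (λ x s → x ∧ not s) (Graph.sym G i j)
                       (does-⇔ (mk⇔ SameEdge-flip SameEdge-flip) (sameEdge? i j a b) (sameEdge? j i a b))
  ; irrefl = λ i → cong (_∧ _) (Graph.irrefl G i)
  }

deleteEdge-⊆ : ∀ {n} (G : Graph n) a b → adj (deleteEdge G a b) ⊆ᵃ adj G
deleteEdge-⊆ G a b i j e with adj G i j
... | true = refl
... | false = e

deleteEdge-keeps : ∀ {n} (G : Graph n) {a b i j} → adj G i j ≡ true → ¬ SameEdge i j a b →
                   adj (deleteEdge G a b) i j ≡ true
deleteEdge-keeps G {a} {b} {i} {j} e ¬s rewrite e | dec-false (sameEdge? i j a b) ¬s = refl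

deleteEdge-deletes : ∀ {n} (G : Graph n) a b → adj (deleteEdge G a b) a b ≡ false
deleteEdge-deletes G a b rewrite dec-true (sameEdge? a b a b) (inj₁ (refl , refl)) = ∧-zeroʳ (adj G a b)

edgeCount-deleteEdge : ∀ {n} (G : Graph n) {a b} → adj G a b ≡ true →
                       edgeCount (deleteEdge G a b) < edgeCount G
edgeCount-deleteEdge G {a} {b} e
  rewrite edgeCount≡edgeCountOf (deleteEdge G a b) | edgeCount≡edgeCountOf G =
  edgeCountOf-mono-< (deleteEdge-⊆ G a b) (adj⇒≢ G e) e (adj-flip G e)
    (deleteEdge-deletes G a b) (trans (Graph.sym (deleteEdge G a b) b a) (deleteEdge-deletes G a b))

deleteEdge-connected : ∀ {n} {G : Graph n} {a b} → Connected G → Walk (deleteEdge G a b) a b →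
                       Connected (deleteEdge G a b)
deleteEdge-connected {G = G} {a} {b} connected detour i j = mapʷ reroute (connected i j)
  where
  reroute : ∀ i j → adj G i j ≡ true → Walk (deleteEdge G a b) i j
  reroute i j e with sameEdge? i j a b
  ... | yes s = walk-SameEdge s detour
  ... | no ¬s = edgeʷ (deleteEdge-keeps G e ¬s)

-- Grow a vertex set S from one vertex along edges leaving it: each new vertex uses up one more edge
-- that is not inside S.
module SpanningBound {n} (G : Graph n) (connected : Connected G) where

  outside : (Fin n → Bool) → ℕ
  outside S = ∑[ i < n ] bit (not (S i))

  notInside : (Fin n → Bool) → Fin n → Fin n → Bool
  notInside S i j = adj G i j ∧ not (S i ∧ S j)

  insert : Fin n → (Fin n → Bool) → Fin n → Bool
  insert y S i = S i ∨ does (i ≟ y)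

  insert-∋ : ∀ S y → insert y S y ≡ true
  insert-∋ S y rewrite dec-true (y ≟ y) refl = ∨-zeroʳ (S y)

  insert-⊇ : ∀ S y i → S i ≡ true → insert y S i ≡ true
  insert-⊇ S y i Si rewrite Si = refl

  outside-insert : ∀ S {y} → S y ≡ false → outside S ≡ suc (outside (insert y S))
  outside-insert S {y} Sy = begin
    outside S                               ≡⟨ cong (λ b → bit (not b) + outside S) (sym (insert-∋ S y)) ⟩
    bit (not (insert y S y)) + outside S    ≡⟨ sum-differ-at {f = bit ∘ not ∘ insert y S} y unchanged ⟩
    bit (not (S y)) + outside (insert y S)  ≡⟨ cong (λ b → bit (not b) + outside (insert y S)) Sy ⟩
    suc (outside (insert y S))              ∎
    where
    open ≡-Reasoning
    unchanged : ∀ i → i ≢ y → bit (not (insert y S i)) ≡ bit (not (S i))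
    unchanged i i≢y rewrite dec-false (i ≟ y) i≢y | ∨-identityʳ (S i) = refl

  outside-full : ∀ S → (∀ i → S i ≡ true) → outside S ≡ 0
  outside-full S full = trans (sum-cong-≗ (λ i → cong (bit ∘ not) (full i))) (sum-replicate-zero n)

  notInside-⊆ : ∀ S → notInside S ⊆ᵃ adj G
  notInside-⊆ S i j e with adj G i j
  ... | true  = refl
  ... | false = e

  notInside-anti : ∀ {S S′} → (∀ i → S i ≡ true → S′ i ≡ true) → notInside S′ ⊆ᵃ notInside S
  notInside-anti {S} S⊆S′ i j e with adj G i j | S i in Si | S j in Sj
  ... | false | _     | _     = e
  ... | true  | false | _     = refl
  ... | true  | true  | false = refl
  ... | true  | true  | true  rewrite S⊆S′ i Si | S⊆S′ j Sj = e

  notInside-inside : ∀ S {i j} → S i ≡ true → S j ≡ true → notInside S i j ≡ false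
  notInside-inside S {i} {j} Si Sj rewrite Si | Sj = ∧-zeroʳ (adj G i j)

  notInside-across : ∀ S {i j} → adj G i j ≡ true → S i ≡ false ⊎ S j ≡ false → notInside S i j ≡ true
  notInside-across S e (inj₁ Si) rewrite e | Si = refl
  notInside-across S {i} e (inj₂ Sj) rewrite e | Sj | ∧-zeroʳ (S i) = refl

  crossing : ∀ (S : Fin n → Bool) {i j} → Walk G i j → S i ≡ true → S j ≡ false →
             ∃[ s ] ∃[ y ] adj G s y ≡ true × S s ≡ true × S y ≡ false
  crossing S here Si Sj = contradiction (trans (sym Si) Sj) λ ()
  crossing S (step {i} {k} e p) Si Sj with S k in Sk
  ... | false = i , k , e , Si , Sk
  ... | true  = crossing S p Sk Sj

  outside≤notInside : ∀ k S {r} → outside S ≡ k → S r ≡ true → outside S ≤ edgeCountOf (notInside S)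
  outside≤notInside zero S out≡0 _ rewrite out≡0 = z≤n
  outside≤notInside (suc k) S {r} out≡1+k Sr
    with x , Sx≢true ← ¬∀⟶∃¬ n (λ i → S i ≡ true) (λ i → S i Data.Bool.≟ true)
                          (λ full → 0≢1+n (trans (sym (outside-full S full)) out≡1+k))
    with s , y , e , Ss , Sy ← crossing S (connected r x) Sr (¬-not Sx≢true) = begin
    outside S                              ≡⟨ outside-insert S Sy ⟩
    suc (outside S′)                       ≤⟨ s≤s (outside≤notInside k S′ out′≡k (insert-⊇ S y r Sr)) ⟩
    suc (edgeCountOf (notInside S′))       ≤⟨ edgeCountOf-mono-< (notInside-anti (insert-⊇ S y)) (adj⇒≢ G e)
                                                (notInside-across S e (inj₂ Sy))
                                                (notInside-across S (adj-flip G e) (inj₁ Sy))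
                                                (notInside-inside S′ (insert-⊇ S y s Ss) (insert-∋ S y))
                                                (notInside-inside S′ (insert-∋ S y) (insert-⊇ S y s Ss)) ⟩
    edgeCountOf (notInside S)              ∎
    where
    open ≤-Reasoning
    S′ : Fin n → Bool
    S′ = insert y S
    out′≡k : outside S′ ≡ k
    out′≡k = suc-injective (trans (sym (outside-insert S Sy)) out≡1+k)

connected⇒n≤suc-edgeCount : ∀ {n} {G : Graph n} → Connected G → n ≤ suc (edgeCount G)
connected⇒n≤suc-edgeCount {zero} _ = z≤n
connected⇒n≤suc-edgeCount {suc n} {G} connected = begin
  suc n                               ≡⟨ sym (sum-ones (suc n)) ⟩
  outside (λ _ → false)               ≡⟨ outside-insert (λ _ → false) {fzero} refl ⟩
  suc (outside S₀)                    ≤⟨ s≤s (outside≤notInside _ S₀ {fzero} refl (insert-∋ (λ _ → false) fzero)) ⟩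
  suc (edgeCountOf (notInside S₀))    ≤⟨ s≤s (edgeCountOf-mono (notInside-⊆ S₀)) ⟩
  suc (edgeCountOf (adj G))           ≡⟨ cong suc (sym (edgeCount≡edgeCountOf G)) ⟩
  suc (edgeCount G)                   ∎
  where
  open SpanningBound G connected
  open ≤-Reasoning
  S₀ : Fin (suc n) → Bool
  S₀ = insert fzero (λ _ → false)

Bicyclic : ∀ {n} → Graph n → Set
Bicyclic {n} K = Connected K × edgeCount K ≡ n + 1

no-three-redundant-edges : ∀ {n} {K : Graph n} {a₁ b₁ a₂ b₂ a₃ b₃ : Fin n} → Bicyclic K →
  adj K a₁ b₁ ≡ true → adj K a₂ b₂ ≡ true → adj K a₃ b₃ ≡ true →
  ¬ SameEdge a₂ b₂ a₁ b₁ → ¬ SameEdge a₃ b₃ a₁ b₁ → ¬ SameEdge a₃ b₃ a₂ b₂ →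
  let K₃ = deleteEdge (deleteEdge (deleteEdge K a₁ b₁) a₂ b₂) a₃ b₃ in
  Walk K₃ a₁ b₁ → Walk K₃ a₂ b₂ → Walk K₃ a₃ b₃ → ⊥
no-three-redundant-edges {n} {K} {a₁} {b₁} {a₂} {b₂} {a₃} {b₃}
  (connected , size) e₁ e₂ e₃ e₂≢e₁ e₃≢e₁ e₃≢e₂ w₁ w₂ w₃ = n≮n _ (≤-trans too-many too-few)
  where
  K₁ K₂ K₃ : Graph n
  K₁ = deleteEdge K a₁ b₁
  K₂ = deleteEdge K₁ a₂ b₂
  K₃ = deleteEdge K₂ a₃ b₃
  K₂⊆K₁ : adj K₂ ⊆ᵃ adj K₁
  K₂⊆K₁ = deleteEdge-⊆ K₁ a₂ b₂
  K₃⊆K₂ : adj K₃ ⊆ᵃ adj K₂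
  K₃⊆K₂ = deleteEdge-⊆ K₂ a₃ b₃
  e₂∈K₁ : adj K₁ a₂ b₂ ≡ true
  e₂∈K₁ = deleteEdge-keeps K e₂ e₂≢e₁
  e₃∈K₂ : adj K₂ a₃ b₃ ≡ true
  e₃∈K₂ = deleteEdge-keeps K₁ (deleteEdge-keeps K e₃ e₃≢e₁) e₃≢e₂
  connected₁ : Connected K₁
  connected₁ = deleteEdge-connected {G = K} connected (weakenʷ {H = K₁} K₂⊆K₁ (weakenʷ {H = K₂} K₃⊆K₂ w₁))
  connected₂ : Connected K₂
  connected₂ = deleteEdge-connected {G = K₁} connected₁ (weakenʷ {H = K₂} K₃⊆K₂ w₂)
  connected₃ : Connected K₃
  connected₃ = deleteEdge-connected {G = K₂} connected₂ w₃
  too-many : suc (suc (suc (edgeCount K₃))) ≤ suc n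
  too-many = begin
    suc (suc (suc (edgeCount K₃))) ≤⟨ s≤s (s≤s (edgeCount-deleteEdge K₂ e₃∈K₂)) ⟩
    suc (suc (edgeCount K₂))       ≤⟨ s≤s (edgeCount-deleteEdge K₁ e₂∈K₁) ⟩
    suc (edgeCount K₁)             ≤⟨ edgeCount-deleteEdge K e₁ ⟩
    edgeCount K                    ≡⟨ trans size (+-comm n 1) ⟩
    suc n                          ∎
    where open ≤-Reasoning
  too-few : suc n ≤ suc (suc (edgeCount K₃))
  too-few = s≤s (connected⇒n≤suc-edgeCount connected₃)

module TwoSwitch {n} (G : Graph n) {a b c d : Fin n}
  (a≢b : a ≢ b) (a≢c : a ≢ c) (a≢d : a ≢ d) (b≢c : b ≢ c) (b≢d : b ≢ d) (c≢d : c ≢ d)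
  (ab : adj G a b ≡ true) (cd : adj G c d ≡ true) (ad : adj G a d ≡ false) (bc : adj G b c ≡ false) where

  -- The edges of the 4-cycle a b c d a, whose adjacency the switch flips.
  Toggled : Fin n → Fin n → Set
  Toggled i j = SameEdge i j a b ⊎ SameEdge i j c d ⊎ SameEdge i j a d ⊎ SameEdge i j b c

  toggled? : ∀ i j → Dec (Toggled i j)
  toggled? i j = sameEdge? i j a b ⊎-dec sameEdge? i j c d ⊎-dec sameEdge? i j a d ⊎-dec sameEdge? i j b c

  Toggled-flip : ∀ {i j} → Toggled i j → Toggled j i
  Toggled-flip = Sum.map SameEdge-flip (Sum.map SameEdge-flip (Sum.map SameEdge-flip SameEdge-flip))

  ¬Toggled-loop : ∀ {i} → ¬ Toggled i i
  ¬Toggled-loop = [ loop a≢b , [ loop c≢d , [ loop a≢d , loop b≢c ] ] ]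
    where
    loop : ∀ {i x y} → x ≢ y → ¬ SameEdge i i x y
    loop x≢y (inj₁ (refl , refl)) = x≢y refl
    loop x≢y (inj₂ (refl , refl)) = x≢y refl

  switched : Graph n
  switched = record
    { adj    = λ i j → adj G i j xor does (toggled? i j)
    ; sym    = λ i j → cong₂ _xor_ (Graph.sym G i j)
                         (does-⇔ (mk⇔ Toggled-flip Toggled-flip) (toggled? i j) (toggled? j i))
    ; irrefl = λ i → cong₂ _xor_ (Graph.irrefl G i) (dec-false (toggled? i i) ¬Toggled-loop)
    }

  ¬Toggled-outside : ∀ {i j} → i ≢ a → i ≢ b → i ≢ c → i ≢ d → ¬ Toggled i j
  ¬Toggled-outside i≢a i≢b i≢c i≢d =
    [ ¬SameEdge (inj₁ i≢a) (inj₁ i≢b) , [ ¬SameEdge (inj₁ i≢c) (inj₁ i≢d) ,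
    [ ¬SameEdge (inj₁ i≢a) (inj₁ i≢d) , ¬SameEdge (inj₁ i≢b) (inj₁ i≢c) ] ] ]

  switched-outside : ∀ {i j} → i ≢ a → i ≢ b → i ≢ c → i ≢ d → adj switched i j ≡ adj G i j
  switched-outside {i} {j} i≢a i≢b i≢c i≢d
    rewrite dec-false (toggled? i j) (¬Toggled-outside i≢a i≢b i≢c i≢d) = xor-identityʳ (adj G i j)

  switched-added : ∀ {i j} → adj G i j ≡ false → Toggled i j → adj switched i j ≡ true
  switched-added {i} {j} e t rewrite e | dec-true (toggled? i j) t = refl

  switched-ad : adj switched a d ≡ true
  switched-ad = switched-added ad (inj₂ (inj₂ (inj₁ (inj₁ (refl , refl)))))

  switched-bc : adj switched b c ≡ true
  switched-bc = switched-added bc (inj₂ (inj₂ (inj₂ (inj₁ (refl , refl)))))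

  deg-switched-cycle : ∀ {i p q} → p ≢ q → Toggled i p → Toggled i q →
    (∀ j → j ≢ p → j ≢ q → ¬ Toggled i j) → adj G i p ≡ true → adj G i q ≡ false →
    deg switched i ≡ deg G i
  deg-switched-cycle {i} {p} {q} p≢q tp tq off ip iq = begin
    deg switched i                        ≡⟨ deg≡sum switched i ⟩
    ∑[ j < n ] bit (adj G i j xor τ j)    ≡⟨ sum-bit-xor (adj G i) τ p≢q (dec-true (toggled? i p) tp)
                                               (dec-true (toggled? i q) tq)
                                               (λ j j≢p j≢q → dec-false (toggled? i j) (off j j≢p j≢q))
                                               (trans ip (cong not (sym iq))) ⟩
    ∑[ j < n ] bit (adj G i j)            ≡⟨ sym (deg≡sum G i) ⟩
    deg G i                               ∎
    where
    open ≡-Reasoning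
    τ : Fin n → Bool
    τ j = does (toggled? i j)

  deg-switched : ∀ i → deg switched i ≡ deg G i
  deg-switched i = by-cases (i ≟ a) (i ≟ b) (i ≟ c) (i ≟ d)
    where
    by-cases : ∀ {i} → Dec (i ≡ a) → Dec (i ≡ b) → Dec (i ≡ c) → Dec (i ≡ d) → deg switched i ≡ deg G i
    by-cases (yes refl) _ _ _ = deg-switched-cycle b≢d
      (inj₁ (inj₁ (refl , refl))) (inj₂ (inj₂ (inj₁ (inj₁ (refl , refl)))))
      (λ j j≢b j≢d → [ ¬SameEdge (inj₂ j≢b) (inj₁ a≢b)
                     , [ ¬SameEdge (inj₁ a≢c) (inj₁ a≢d)
                     , [ ¬SameEdge (inj₂ j≢d) (inj₁ a≢d)
                       , ¬SameEdge (inj₁ a≢b) (inj₁ a≢c) ] ] ])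
      ab ad
    by-cases (no _) (yes refl) _ _ = deg-switched-cycle a≢c
      (inj₁ (inj₂ (refl , refl))) (inj₂ (inj₂ (inj₂ (inj₁ (refl , refl)))))
      (λ j j≢a j≢c → [ ¬SameEdge (inj₁ (≢-sym a≢b)) (inj₂ j≢a)
                     , [ ¬SameEdge (inj₁ b≢c) (inj₁ b≢d)
                     , [ ¬SameEdge (inj₁ (≢-sym a≢b)) (inj₁ b≢d)
                       , ¬SameEdge (inj₂ j≢c) (inj₁ b≢c) ] ] ])
      (adj-flip G ab) bc
    by-cases (no _) (no _) (yes refl) _ = deg-switched-cycle (≢-sym b≢d)
      (inj₂ (inj₁ (inj₁ (refl , refl)))) (inj₂ (inj₂ (inj₂ (inj₂ (refl , refl)))))
      (λ j j≢d j≢b → [ ¬SameEdge (inj₁ (≢-sym a≢c)) (inj₁ (≢-sym b≢c))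
                     , [ ¬SameEdge (inj₂ j≢d) (inj₁ c≢d)
                     , [ ¬SameEdge (inj₁ (≢-sym a≢c)) (inj₁ c≢d)
                       , ¬SameEdge (inj₁ (≢-sym b≢c)) (inj₂ j≢b) ] ] ])
      cd (trans (Graph.sym G c b) bc)
    by-cases (no _) (no _) (no _) (yes refl) = deg-switched-cycle (≢-sym a≢c)
      (inj₂ (inj₁ (inj₂ (refl , refl)))) (inj₂ (inj₂ (inj₁ (inj₂ (refl , refl)))))
      (λ j j≢c j≢a → [ ¬SameEdge (inj₁ (≢-sym a≢d)) (inj₁ (≢-sym b≢d))
                     , [ ¬SameEdge (inj₁ (≢-sym c≢d)) (inj₂ j≢c)
                     , [ ¬SameEdge (inj₁ (≢-sym a≢d)) (inj₂ j≢a)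
                       , ¬SameEdge (inj₁ (≢-sym b≢d)) (inj₁ (≢-sym c≢d)) ] ] ])
      (adj-flip G cd) (trans (Graph.sym G d a) ad)
    by-cases {i} (no i≢a) (no i≢b) (no i≢c) (no i≢d) = trans (deg≡sum switched i)
      (trans (sum-cong-≗ (λ j → cong bit (switched-outside {j = j} i≢a i≢b i≢c i≢d))) (sym (deg≡sum G i)))

clamp : (t k : ℕ) → Fin (suc t)
clamp t       zero    = fzero
clamp zero    (suc k) = fzero
clamp (suc t) (suc k) = fsuc (clamp t k)

toℕ-clamp : ∀ {t k} → k ≤ t → toℕ (clamp t k) ≡ k
toℕ-clamp {k = zero} _ = refl
toℕ-clamp {suc t} {suc k} (s≤s k≤t) = cong suc (toℕ-clamp k≤t)

clamp-toℕ : ∀ {t} (a : Fin (suc t)) → clamp t (toℕ a) ≡ a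
clamp-toℕ fzero = refl
clamp-toℕ {suc t} (fsuc a) = cong fsuc (clamp-toℕ a)

-- The ends of the theta are u = y 0 and v = y t, and w is the inner vertex of its path of length 2.
record Theta₁₂ {n} (G : Graph n) (t : ℕ) : Set where
  field
    w           : Fin n
    y           : ℕ → Fin n
    y-injective : ∀ {i j} → i ≤ t → j ≤ t → y i ≡ y j → i ≡ j
    w≢y         : ∀ {k} → k ≤ t → w ≢ y k
    path        : ∀ {k} → k < t → adj G (y k) (y (suc k)) ≡ true
    uw          : adj G (y 0) w ≡ true
    wv          : adj G w (y t) ≡ true
    uv          : adj G (y 0) (y t) ≡ true

theta₁₂ : ∀ {n} {G : Graph n} {t} → ContainsTheta G 1 2 t → Theta₁₂ G t
theta₁₂ {n} {G} {t} (u , v , _ , P , Q , R , _ , _ , Q∩R⊆uv , _) = record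
  { w           = vert Q (fsuc fzero)
  ; y           = y
  ; y-injective = λ {i} {j} i≤t j≤t e →
                    trans (sym (toℕ-clamp i≤t)) (trans (cong toℕ (inj R _ _ e)) (toℕ-clamp j≤t))
  ; w≢y         = λ {k} _ e → [ w≢u , w≢v ] (Q∩R⊆uv (fsuc fzero) (clamp t k) e)
  ; path        = λ {k} k<t → subst₂ (λ i j → adj G (y i) (y j) ≡ true)
                    (trans (toℕ-inject₁ (fromℕ< k<t)) (toℕ-fromℕ< k<t)) (cong suc (toℕ-fromℕ< k<t))
                    (subst₂ (λ a b → adj G a b ≡ true) (sym (y-toℕ _)) (sym (y-toℕ _))
                            (edges R (fromℕ< k<t)))
  ; uw          = subst₂ (λ a b → adj G a b ≡ true) (trans (start Q) (sym (start R))) refl (edges Q fzero)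
  ; wv          = subst (λ b → adj G (vert Q (fsuc fzero)) b ≡ true) (trans (end Q) v≡yt)
                    (edges Q (fsuc fzero))
  ; uv          = subst₂ (λ a b → adj G a b ≡ true) (trans (start P) (sym (start R))) (trans (end P) v≡yt)
                    (edges P fzero)
  }
  where
  y : ℕ → Fin n
  y k = vert R (clamp t k)
  y-toℕ : (a : Fin (suc t)) → y (toℕ a) ≡ vert R a
  y-toℕ a = cong (vert R) (clamp-toℕ a)
  v≡yt : v ≡ y t
  v≡yt = trans (sym (end R)) (trans (sym (y-toℕ (fromℕ t))) (cong y (toℕ-fromℕ t)))
  w≢u : vert Q (fsuc fzero) ≢ u
  w≢u e with () ← inj Q (fsuc fzero) fzero (trans e (sym (start Q)))
  w≢v : vert Q (fsuc fzero) ≢ v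
  w≢v e with () ← inj Q (fsuc fzero) (fsuc (fsuc fzero)) (trans e (sym (end Q)))

theta-length≥2 : ∀ {n} {G : Graph n} {t} → ContainsTheta G 1 2 t → 2 ≤ t
theta-length≥2 {t = zero} (u , v , u≢v , _ , _ , R , _) = contradiction (trans (sym (start R)) (end R)) u≢v
theta-length≥2 {t = suc zero} (_ , _ , _ , P , _ , R , _ , (_ , P-R-edge-disjoint) , _) =
  contradiction (inj₁ (trans (start P) (sym (start R)) , trans (end P) (sym (end R))))
                (P-R-edge-disjoint fzero fzero)
theta-length≥2 {t = suc (suc t)} _ = s≤s (s≤s z≤n)

module LongTheta {n} {G : Graph n} {m} (θ : Theta₁₂ G (5 + m)) where
  open Theta₁₂ θ

  t : ℕ
  t = 5 + m

  small : ∀ k → T (k ≤ᵇ 5) → k ≤ t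
  small k k≤5 = ≤-trans (≤ᵇ⇒≤ k 5 k≤5) (m≤m+n 5 m)

  -- Side conditions on numerals are implicit arguments that evaluate to ⊤.
  y≢y : ∀ i j {i≤5 : T (i ≤ᵇ 5)} {j≤5 : T (j ≤ᵇ 5)} {i≢j : False (i ℕ.≟ j)} → y i ≢ y j
  y≢y i j {i≤5} {j≤5} {i≢j} = toWitnessFalse i≢j ∘ y-injective (small i i≤5) (small j j≤5)

  y≢w : ∀ k {k≤5 : T (k ≤ᵇ 5)} → y k ≢ w
  y≢w k {k≤5} = ≢-sym (w≢y (small k k≤5))

  y-above : ∀ {i j} → j < i → i ≤ t → y i ≢ y j
  y-above j<i i≤t e = <⇒≢ j<i (sym (y-injective i≤t (≤-trans (<⇒≤ j<i) i≤t) e))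

  path-at : ∀ k {k<5 : T (k <ᵇ 5)} → adj G (y k) (y (suc k)) ≡ true
  path-at k {k<5} = path (≤-trans (<ᵇ⇒< k 5 k<5) (m≤m+n 5 m))

  Outer : Fin n → Set
  Outer x = x ≢ w × x ≢ y 0 × x ≢ y 1 × x ≢ y 2 × x ≢ y 3

  outer : ∀ {k} → 4 ≤ k → k ≤ t → Outer (y k)
  outer 4≤k k≤t = ≢-sym (w≢y k≤t) , below 0 , below 1 , below 2 , below 3
    where
    below : ∀ j {j<4 : T (j <ᵇ 4)} → _ ≢ y j
    below j {j<4} = y-above (<-≤-trans (<ᵇ⇒< j 4 j<4) 4≤k) k≤t

  outer-4 : Outer (y 4)
  outer-4 = outer ≤-refl (small 4 _)

  outer-5 : Outer (y 5)
  outer-5 = outer (n≤1+n 4) (small 5 _)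

  outer-t : Outer (y t)
  outer-t = outer (m≤m+n 4 (suc m)) ≤-refl

  PathFrom : Graph n → ℕ → Set
  PathFrom K lo = ∀ k → lo ≤ k → k < t → adj K (y k) (y (suc k)) ≡ true

  -- One edge from each of the cycles u w v, y₂ y₃ … and u y₁ … of K.
  module Deleted (K : Graph n) where

    K₃ : Graph n
    K₃ = deleteEdge (deleteEdge (deleteEdge K (y 0) w) (y 2) (y 3)) (y 0) (y 1)

    Spared : Fin n → Fin n → Set
    Spared i j = ¬ SameEdge i j (y 0) w × ¬ SameEdge i j (y 2) (y 3) × ¬ SameEdge i j (y 0) (y 1)

    spared-to : ∀ {i j} → Outer j → Spared i j
    spared-to (≢w , ≢y₀ , ≢y₁ , ≢y₂ , ≢y₃) =
      ¬SameEdge (inj₂ ≢w) (inj₂ ≢y₀) , ¬SameEdge (inj₂ ≢y₃) (inj₂ ≢y₂) , ¬SameEdge (inj₂ ≢y₁) (inj₂ ≢y₀)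

    spared-y₁y₂ : Spared (y 1) (y 2)
    spared-y₁y₂ = ¬SameEdge (inj₁ (y≢y 1 0)) (inj₁ (y≢w 1)) , ¬SameEdge (inj₁ (y≢y 1 2)) (inj₁ (y≢y 1 3)) ,
                ¬SameEdge (inj₁ (y≢y 1 0)) (inj₂ (y≢y 2 0))

    spared : ∀ {i j} → adj K i j ≡ true → Spared i j → adj K₃ i j ≡ true
    spared e (s₁ , s₂ , s₃) = deleteEdge-keeps (deleteEdge (deleteEdge K (y 0) w) (y 2) (y 3))
      (deleteEdge-keeps (deleteEdge K (y 0) w) (deleteEdge-keeps K e s₁) s₂) s₃

    edge : ∀ {i j} → adj K i j ≡ true → Spared i j → Walk K₃ i j
    edge e s = edgeʷ (spared e s)

    edge⁻ : ∀ {i j} → adj K j i ≡ true → Spared j i → Walk K₃ i j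
    edge⁻ e s = reverseʷ (edge e s)

    tail : ∀ {lo} → 4 ≤ lo → lo ≤ t → PathFrom K lo → Walk K₃ (y lo) (y t)
    tail 4≤lo lo≤t p = walk-along y (≤⇒≤′ lo≤t) λ k lo≤k k<t →
      spared (p k lo≤k k<t) (spared-to (outer (≤-trans 4≤lo (≤-trans lo≤k (n≤1+n k))) k<t))

    u⇝w : adj K (y 0) (y t) ≡ true → adj K w (y t) ≡ true → Walk K₃ (y 0) w
    u⇝w uv wv = edge uv (spared-to outer-t) ++ʷ edge⁻ wv (spared-to outer-t)

    y₂⇝y₃-via-y₄ : adj K (y 2) (y 4) ≡ true → adj K (y 3) (y 4) ≡ true → Walk K₃ (y 2) (y 3)
    y₂⇝y₃-via-y₄ e₂₄ e₃₄ = edge e₂₄ (spared-to outer-4) ++ʷ edge⁻ e₃₄ (spared-to outer-4)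

    y₂⇝y₃-via-y₁y₅ : adj K (y 1) (y 2) ≡ true → adj K (y 1) (y 5) ≡ true → adj K (y 4) (y 5) ≡ true →
                     adj K (y 3) (y 4) ≡ true → Walk K₃ (y 2) (y 3)
    y₂⇝y₃-via-y₁y₅ e₁₂ e₁₅ e₄₅ e₃₄ =
      edge⁻ e₁₂ spared-y₁y₂ ++ʷ edge e₁₅ (spared-to outer-5) ++ʷ edge⁻ e₄₅ (spared-to outer-5) ++ʷ
      edge⁻ e₃₄ (spared-to outer-4)

    u⇝y₁-via-y₄ : adj K (y 0) (y t) ≡ true → PathFrom K 4 → adj K (y 2) (y 4) ≡ true →
                  adj K (y 1) (y 2) ≡ true → Walk K₃ (y 0) (y 1)
    u⇝y₁-via-y₄ uv p e₂₄ e₁₂ =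
      edge uv (spared-to outer-t) ++ʷ reverseʷ (tail ≤-refl (small 4 _) p) ++ʷ
      edge⁻ e₂₄ (spared-to outer-4) ++ʷ edge⁻ e₁₂ spared-y₁y₂

    u⇝y₁-via-y₅ : adj K (y 0) (y t) ≡ true → PathFrom K 5 → adj K (y 1) (y 5) ≡ true → Walk K₃ (y 0) (y 1)
    u⇝y₁-via-y₅ uv p e₁₅ =
      edge uv (spared-to outer-t) ++ʷ reverseʷ (tail (n≤1+n 4) (small 5 _) p) ++ʷ
      edge⁻ e₁₅ (spared-to outer-5)

    not-bicyclic : Bicyclic K →
                   adj K (y 0) w ≡ true → adj K (y 2) (y 3) ≡ true → adj K (y 0) (y 1) ≡ true →
                   adj K (y 0) (y t) ≡ true → adj K w (y t) ≡ true →
                   Walk K₃ (y 2) (y 3) → Walk K₃ (y 0) (y 1) → ⊥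
    not-bicyclic bicyclic uw′ e₂₃ e₀₁ uv′ wv′ =
      no-three-redundant-edges bicyclic uw′ e₂₃ e₀₁
        (¬SameEdge (inj₁ (y≢y 2 0)) (inj₁ (y≢w 2)))
        (¬SameEdge (inj₂ (y≢w 1)) (inj₁ (y≢w 0)))
        (¬SameEdge (inj₁ (y≢y 0 2)) (inj₁ (y≢y 0 3)))
        (u⇝w uv′ wv′)

  ¬bicyclic : ∀ {D} → ((K : Graph n) → Realization K D → Bicyclic K) → Realization G D → ⊥
  ¬bicyclic bicyclic real with adj G (y 2) (y 4) in e₂₄ | adj G (y 1) (y 5) in e₁₅
  ... | true | _ =
    not-bicyclic (bicyclic G real) uw (path-at 2) (path-at 0) uv wv
      (y₂⇝y₃-via-y₄ e₂₄ (path-at 3)) (u⇝y₁-via-y₄ uv (λ _ _ → path) e₂₄ (path-at 1))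
    where open Deleted G
  ... | false | true =
    not-bicyclic (bicyclic G real) uw (path-at 2) (path-at 0) uv wv
      (y₂⇝y₃-via-y₁y₅ (path-at 1) e₁₅ (path-at 4) (path-at 3)) (u⇝y₁-via-y₅ uv (λ _ _ → path) e₁₅)
    where open Deleted G
  ... | false | false =
    -- neither chord is an edge of G, so the 2-switch on y₁ y₂ y₄ y₅ creates both
    not-bicyclic (bicyclic switched (λ i → trans (deg-switched i) (real i)))
      (kept₀ uw) (adj-flip switched (kept₃ (adj-flip G (path-at 2)))) (kept₀ (path-at 0)) (kept₀ uv)
      (keep (≢-sym (y≢w 1)) (≢-sym (y≢w 2)) (≢-sym (y≢w 4)) (≢-sym (y≢w 5)) wv)
      (y₂⇝y₃-via-y₄ switched-bc (kept₃ (path-at 3))) (u⇝y₁-via-y₅ (kept₀ uv) tail-kept switched-ad)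
    where
    open TwoSwitch G (y≢y 1 2) (y≢y 1 4) (y≢y 1 5) (y≢y 2 4) (y≢y 2 5) (y≢y 4 5)
                     (path-at 1) (path-at 4) e₁₅ e₂₄
    open Deleted switched
    keep : ∀ {i j} → i ≢ y 1 → i ≢ y 2 → i ≢ y 4 → i ≢ y 5 → adj G i j ≡ true → adj switched i j ≡ true
    keep i≢y₁ i≢y₂ i≢y₄ i≢y₅ e = trans (switched-outside i≢y₁ i≢y₂ i≢y₄ i≢y₅) e
    kept₀ : ∀ {j} → adj G (y 0) j ≡ true → adj switched (y 0) j ≡ true
    kept₀ = keep (y≢y 0 1) (y≢y 0 2) (y≢y 0 4) (y≢y 0 5)
    kept₃ : ∀ {j} → adj G (y 3) j ≡ true → adj switched (y 3) j ≡ true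
    kept₃ = keep (y≢y 3 1) (y≢y 3 2) (y≢y 3 4) (y≢y 3 5)
    tail-kept : PathFrom switched 5
    tail-kept k 5≤k k<t =
      adj-flip switched (keep (beyond 1) (beyond 2) (beyond 4) (beyond 5) (adj-flip G (path k<t)))
      where
      beyond : ∀ j {j≤5 : T (j ≤ᵇ 5)} → y (suc k) ≢ y j
      beyond j {j≤5} = y-above (s≤s (≤-trans (≤ᵇ⇒≤ j 5 j≤5) 5≤k)) k<t

theta-length≤4 : ∀ {n} {D : Fin n → ℕ} → ((K : Graph n) → Realization K D → Bicyclic K) →
                 ∀ {G : Graph n} → Realization G D → ∀ {t} → ContainsTheta G 1 2 t → t ≤ 4
theta-length≤4 bicyclic real {t} θ with t ℕ.≤? 4
... | yes t≤4 = t≤4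
... | no t≰4 with m , refl ← m≤n⇒∃[o]m+o≡n (≰⇒> t≰4) =
  contradiction real (LongTheta.¬bicyclic (theta₁₂ θ) bicyclic)

lemma4p6 : ∀ {n} (D : Fin n → ℕ) → ForciblyBicyclic D →
           (G : Graph n) → Realization G D → (t : ℕ) → ContainsTheta G 1 2 t →
           2 ≤ t × t ≤ 4
lemma4p6 D (_ , bicyclic) G real t θ = theta-length≥2 θ , theta-length≤4 bicyclic real θ
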